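{- Let $n\ge 2$ and let $(a_1,a_2,\dots,a_n)\in\mathbb{N}^n$ with $a_1\ge 2$. Choose a prime $\ell>\max\{a_1,\dots,a_n\}$ and write its base-$a_1$ expansion as \[ \ell = c_d a_1^{d-1}+c_{d-1}a_1^{d-2}+\cdots+c_1,\qquad 0\le c_i<a_1,\ c_d\ne 0. \] For each $2\le k\le n$ define \[ \mathcal{P}_k(x)=\frac{a_k}{\ell\,a_1}\,x\,\bigl(c_d x^{d-1}+c_{d-1}x^{d-2}+\cdots+c_1\bigr), \] and consider the curve $\Gamma:[0,a_1]\to\mathbb{R}^n$, $\Gamma(x)=\bigl(x,\mathcal{P}_2(x),\dots,\mathcal{P}_n(x)\bigr)$. Then: (a) $\Gamma(0)=(0,0,\dots,0)$ and $\Gamma(a_1)=(a_1,a_2,\dots,a_n)$; (b) for every integer $1\le x\le a_1-1$, none of the numbers $\mathcal{P}_k(x)$ ($2\le k\le n$) is an integer; hence $\Gamma$ meets no lattice point of $\mathbb{Z}^n$ other than $\Gamma(0)$ and $\Gamma(a_1)$.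
   Context: $\mathbb{N}=\{1,2,3,\dots\}$.
   Formalization: The curve Γ and the polynomials $\mathcal{P}_k$ are taken over ℚ, with Γ defined on the rational points of $[0,a_1]$ rather than on the real interval. -}

module Defs where

open import Data.Nat using (ℕ; zero; suc; _+_; _*_)
open import Data.Integer using (ℤ; +_)
open import Data.Rational using (ℚ; _/_; 0ℚ)
import Data.Rational as ℚ
open import Data.List using (List; []; _∷_)
open import Data.Fin using (Fin; zero; suc)
open import Data.Product using (∃)
open import Relation.Binary.PropositionalEquality using (_≡_)

ℕ→ℚ : ℕ → ℚ
ℕ→ℚ n = + n / 1

ℤ→ℚ : ℤ → ℚ
ℤ→ℚ z = z / 1

IsInt : ℚ → Set
IsInt q = ∃ λ (z : ℤ) → q ≡ ℤ→ℚ z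

-- digits listed least significant first: [c₁, c₂, …, c_d]
-- evalℕ [c₁,…,c_d] x = c₁ + c₂ x + … + c_d x^(d-1)
evalℕ : List ℕ → ℕ → ℕ
evalℕ [] x = 0
evalℕ (c ∷ cs) x = c + x * evalℕ cs x

evalℚ : List ℕ → ℚ → ℚ
evalℚ [] x = 0ℚ
evalℚ (c ∷ cs) x = ℕ→ℚ c ℚ.+ x ℚ.* evalℚ cs x

-- n / d as a rational (d = 0 never occurs in the statement; default 0)
frac : ℕ → ℕ → ℚ
frac n zero = 0ℚ
frac n (suc d) = + n / suc d

-- 𝒫_k(x) = a_k / (ℓ a₁) · x · (c_d x^(d-1) + … + c₁); index zero is a₁
𝒫 : ∀ {n} → (Fin (suc n) → ℕ) → (ℓ : ℕ) → (cs : List ℕ) → Fin (suc n) → ℚ → ℚ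
𝒫 a ℓ cs k x = frac (a k) (ℓ * a zero) ℚ.* (x ℚ.* evalℚ cs x)

Γ : ∀ {n} → (Fin (suc n) → ℕ) → (ℓ : ℕ) → (cs : List ℕ) → ℚ → Fin (suc n) → ℚ
Γ a ℓ cs x zero = x
Γ a ℓ cs x (suc k) = 𝒫 a ℓ cs (suc k) x

-- For an integer x the value 𝒫ₖ(x) is the fraction aₖ · x · P(x) / (ℓ a₁), where P is the
-- polynomial whose coefficients are the base-a₁ digits of ℓ, so that P(a₁) = ℓ. For 0 < x < a₁
-- each of aₖ, x and P(x) is positive and smaller than ℓ (P is increasing and not constant, since
-- its leading digit is below ℓ), so the prime ℓ divides none of them and 𝒫ₖ(x) is not an integer.
-- A lattice point of Γ has an integral first coordinate x ∈ [0, a₁], and by the above x is an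
-- endpoint.
module Submission where

open import Defs
open import Data.Nat using (ℕ; _+_; _≤_; _<_)
open import Data.Nat.Primality using (Prime)
open import Data.Rational using (ℚ; 0ℚ)
import Data.Rational as ℚ
open import Data.List using (List; _∷ʳ_)
open import Data.List.Relation.Unary.All using (All)
open import Data.Fin using (Fin; zero; suc)
open import Data.Product using (_×_)
open import Data.Sum using (_⊎_)
open import Relation.Nullary using (¬_)
open import Relation.Binary.PropositionalEquality using (_≡_; _≢_)

import Data.Nat as ℕ
open import Data.Nat using (_*_; NonZero; >-nonZero; z≤n)
import Data.Nat.Properties as ℕ
open import Data.Nat.Divisibility using (_∣_; _∤_; divides; ∣-trans; m∣m*n; >⇒∤)
open import Data.Nat.Primality using (euclidsLemma; prime⇒nonZero)
import Data.Integer as ℤ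
open import Data.Integer using (+_; -[1+_]; +≤+)
import Data.Integer.Properties as ℤ
open import Data.Rational using (fromℚᵘ; toℚᵘ)
open import Data.Rational.Properties
  using (toℚᵘ-injective; fromℚᵘ-injective; toℚᵘ-fromℚᵘ; fromℚᵘ-cong; toℚᵘ-homo-+; toℚᵘ-homo-*;
         toℚᵘ-mono-≤; *-zeroˡ; *-zeroʳ)
import Data.Rational.Unnormalised as ℚᵘ
open import Data.Rational.Unnormalised using (mkℚᵘ; *≡*; *≤*)
import Data.Rational.Unnormalised.Properties as ℚᵘ
open import Data.List using ([]; _∷_)
open import Data.Product using (∃; _,_)
open import Data.Sum using (inj₁; inj₂; [_,_]′)
open import Relation.Nullary using (yes; no; contradiction)
open import Relation.Binary.PropositionalEquality
  using (refl; sym; trans; cong; cong₂; subst; subst₂; module ≡-Reasoning)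

prime∤* : ∀ {p m n} → Prime p → p ∤ m → p ∤ n → p ∤ m * n
prime∤* p-prime p∤m p∤n p∣mn = [ p∤m , p∤n ]′ (euclidsLemma _ _ p-prime p∣mn)

positive<prime⇒∤ : ∀ {p n} → 0 < n → n < p → p ∤ n
positive<prime⇒∤ 0<n n<p = >⇒∤ {{>-nonZero 0<n}} n<p

evalℕ-∷ʳ-pos : ∀ cs {cd x} → 0 < x → 0 < cd → 0 < evalℕ (cs ∷ʳ cd) x
evalℕ-∷ʳ-pos []       {cd} 0<x 0<cd = ℕ.≤-trans 0<cd (ℕ.m≤m+n cd _)
evalℕ-∷ʳ-pos (c ∷ cs)      0<x 0<cd = ℕ.≤-trans (ℕ.*-mono-≤ 0<x (evalℕ-∷ʳ-pos cs 0<x 0<cd)) (ℕ.m≤n+m _ c)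

evalℕ-mono-≤ : ∀ cs {x y} → x ≤ y → evalℕ cs x ≤ evalℕ cs y
evalℕ-mono-≤ []       x≤y = z≤n
evalℕ-mono-≤ (c ∷ cs) x≤y = ℕ.+-monoʳ-≤ c (ℕ.*-mono-≤ x≤y (evalℕ-mono-≤ cs x≤y))

evalℕ-∷-mono-< : ∀ c cs {x y} → x < y → 0 < evalℕ cs y → evalℕ (c ∷ cs) x < evalℕ (c ∷ cs) y
evalℕ-∷-mono-< c cs {x} {y} x<y 0<P[y] = ℕ.+-monoʳ-< c (begin-strict
  x * evalℕ cs x ≤⟨ ℕ.*-monoʳ-≤ x (evalℕ-mono-≤ cs (ℕ.<⇒≤ x<y)) ⟩
  x * evalℕ cs y <⟨ ℕ.*-monoˡ-< (evalℕ cs y) {{>-nonZero 0<P[y]}} x<y ⟩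
  y * evalℕ cs y ∎)
  where open ℕ.≤-Reasoning

evalℕ-∷ʳ-mono-< : ∀ cs {cd x y} → 0 < cd → cd < evalℕ (cs ∷ʳ cd) y → x < y →
                  evalℕ (cs ∷ʳ cd) x < evalℕ (cs ∷ʳ cd) y
evalℕ-∷ʳ-mono-< []       {cd} {y = y} _    cd<P[y] _   = contradiction cd<P[y] (ℕ.<-irrefl (sym P[y]≡cd))
  where
  P[y]≡cd : cd + y * 0 ≡ cd
  P[y]≡cd = trans (cong (cd ℕ.+_) (ℕ.*-zeroʳ y)) (ℕ.+-identityʳ cd)
evalℕ-∷ʳ-mono-< (c ∷ cs) {cd} 0<cd _       x<y =
  evalℕ-∷-mono-< c (cs ∷ʳ cd) x<y (evalℕ-∷ʳ-pos cs (ℕ.≤-<-trans z≤n x<y) 0<cd)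

-- ℕ→ℚ n, frac n (suc d) and ℤ→ℚ z are by definition fromℚᵘ of the unnormalised fractions
-- n/1, n/(suc d) and z/1, so their arithmetic is computed in ℚᵘ and transported along fromℚᵘ.

fromℚᵘ-homo-+ : ∀ p q → fromℚᵘ (p ℚᵘ.+ q) ≡ fromℚᵘ p ℚ.+ fromℚᵘ q
fromℚᵘ-homo-+ p q = toℚᵘ-injective (begin
  toℚᵘ (fromℚᵘ (p ℚᵘ.+ q))               ≈⟨ toℚᵘ-fromℚᵘ (p ℚᵘ.+ q) ⟩
  p ℚᵘ.+ q                                ≈⟨ ℚᵘ.+-cong (toℚᵘ-fromℚᵘ p) (toℚᵘ-fromℚᵘ q) ⟨
  toℚᵘ (fromℚᵘ p) ℚᵘ.+ toℚᵘ (fromℚᵘ q)   ≈⟨ toℚᵘ-homo-+ (fromℚᵘ p) (fromℚᵘ q) ⟨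
  toℚᵘ (fromℚᵘ p ℚ.+ fromℚᵘ q)           ∎)
  where open ℚᵘ.≃-Reasoning

fromℚᵘ-homo-* : ∀ p q → fromℚᵘ (p ℚᵘ.* q) ≡ fromℚᵘ p ℚ.* fromℚᵘ q
fromℚᵘ-homo-* p q = toℚᵘ-injective (begin
  toℚᵘ (fromℚᵘ (p ℚᵘ.* q))               ≈⟨ toℚᵘ-fromℚᵘ (p ℚᵘ.* q) ⟩
  p ℚᵘ.* q                                ≈⟨ ℚᵘ.*-cong (toℚᵘ-fromℚᵘ p) (toℚᵘ-fromℚᵘ q) ⟨
  toℚᵘ (fromℚᵘ p) ℚᵘ.* toℚᵘ (fromℚᵘ q)   ≈⟨ toℚᵘ-homo-* (fromℚᵘ p) (fromℚᵘ q) ⟨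
  toℚᵘ (fromℚᵘ p ℚ.* fromℚᵘ q)           ∎)
  where open ℚᵘ.≃-Reasoning

ℕ→ℚ-homo-+ : ∀ m n → ℕ→ℚ (m + n) ≡ ℕ→ℚ m ℚ.+ ℕ→ℚ n
ℕ→ℚ-homo-+ m n =
  trans (fromℚᵘ-cong {mkℚᵘ (+ (m + n)) 0} {mkℚᵘ (+ m) 0 ℚᵘ.+ mkℚᵘ (+ n) 0} (*≡* (cong (ℤ._* + 1) m+n≡m*1+n*1)))
        (fromℚᵘ-homo-+ (mkℚᵘ (+ m) 0) (mkℚᵘ (+ n) 0))
  where
  m+n≡m*1+n*1 : + (m + n) ≡ + m ℤ.* + 1 ℤ.+ + n ℤ.* + 1
  m+n≡m*1+n*1 = trans (ℤ.pos-+ m n) (sym (cong₂ ℤ._+_ (ℤ.*-identityʳ (+ m)) (ℤ.*-identityʳ (+ n))))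

frac-*-ℕ→ℚ : ∀ n d m → frac n d ℚ.* ℕ→ℚ m ≡ frac (n * m) d
frac-*-ℕ→ℚ n ℕ.zero    m = *-zeroˡ (ℕ→ℚ m)
frac-*-ℕ→ℚ n (ℕ.suc d) m =
  trans (sym (fromℚᵘ-homo-* (mkℚᵘ (+ n) d) (mkℚᵘ (+ m) 0)))
        (fromℚᵘ-cong {mkℚᵘ (+ n) d ℚᵘ.* mkℚᵘ (+ m) 0} {mkℚᵘ (+ (n * m)) d}
          (*≡* (cong₂ ℤ._*_ (sym (ℤ.pos-* n m)) (cong (λ e → + ℕ.suc e) (sym (ℕ.*-identityʳ d))))))

ℕ→ℚ-homo-* : ∀ m n → ℕ→ℚ (m * n) ≡ ℕ→ℚ m ℚ.* ℕ→ℚ n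
ℕ→ℚ-homo-* m n = sym (frac-*-ℕ→ℚ m 1 n)

frac-cancel : ∀ m d .{{_ : NonZero d}} → frac (m * d) d ≡ ℕ→ℚ m
frac-cancel m (ℕ.suc d) = fromℚᵘ-cong {mkℚᵘ (+ (m * ℕ.suc d)) d} {mkℚᵘ (+ m) 0}
  (*≡* (trans (ℤ.*-identityʳ (+ (m * ℕ.suc d))) (ℤ.pos-* m (ℕ.suc d))))

IsInt-frac⇒∣ : ∀ n d .{{_ : NonZero d}} → IsInt (frac n d) → d ∣ n
IsInt-frac⇒∣ n (ℕ.suc d) (z , eq) with fromℚᵘ-injective {mkℚᵘ (+ n) d} {mkℚᵘ z 0} eq
... | *≡* n*1≡z*d = divides ℤ.∣ z ∣ (begin
  n                       ≡⟨ ℕ.*-identityʳ n ⟨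
  n * 1                 ≡⟨ ℤ.abs-* (+ n) (+ 1) ⟨
  ℤ.∣ + n ℤ.* + 1 ∣       ≡⟨ cong ℤ.∣_∣ n*1≡z*d ⟩
  ℤ.∣ z ℤ.* + ℕ.suc d ∣   ≡⟨ ℤ.abs-* z (+ ℕ.suc d) ⟩
  ℤ.∣ z ∣ * ℕ.suc d     ∎)
  where open ≡-Reasoning

ℤ→ℚ-cancel-≤ : ∀ {i j} → ℤ→ℚ i ℚ.≤ ℤ→ℚ j → i ℤ.≤ j
ℤ→ℚ-cancel-≤ {i} {j} i≤j
  with ℚᵘ.≤-respˡ-≃ (toℚᵘ-fromℚᵘ (mkℚᵘ i 0)) (ℚᵘ.≤-respʳ-≃ (toℚᵘ-fromℚᵘ (mkℚᵘ j 0)) (toℚᵘ-mono-≤ i≤j))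
... | *≤* i*1≤j*1 = subst₂ ℤ._≤_ (ℤ.*-identityʳ i) (ℤ.*-identityʳ j) i*1≤j*1

IsInt∩[0,n]⇒ℕ : ∀ {x n} → 0ℚ ℚ.≤ x → x ℚ.≤ ℕ→ℚ n → IsInt x → ∃ λ m → m ≤ n × x ≡ ℕ→ℚ m
IsInt∩[0,n]⇒ℕ       0≤x _   (-[1+ m ] , refl) with () ← ℤ→ℚ-cancel-≤ {+ 0} { -[1+ m ]} 0≤x
IsInt∩[0,n]⇒ℕ {n = n} _ x≤n (+ m , refl) with +≤+ m≤n ← ℤ→ℚ-cancel-≤ {+ m} {+ n} x≤n = m , m≤n , refl

IsInt∩[0,n]⇒endpoint : ∀ {n x} (P : ℚ → Set) → (∀ m → 1 ≤ m → m + 1 ≤ n → ¬ P (ℕ→ℚ m)) →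
                        0ℚ ℚ.≤ x → x ℚ.≤ ℕ→ℚ n → IsInt x → P x → x ≡ 0ℚ ⊎ x ≡ ℕ→ℚ n
IsInt∩[0,n]⇒endpoint {n} P ¬P[interior] 0≤x x≤n x∈ℤ Px with IsInt∩[0,n]⇒ℕ 0≤x x≤n x∈ℤ
... | m , m≤n , refl with m ℕ.≟ 0 | m ℕ.≟ n
...   | yes refl | _        = inj₁ refl
...   | no _     | yes refl = inj₂ refl
...   | no m≢0   | no m≢n   =
  contradiction Px (¬P[interior] m (ℕ.n≢0⇒n>0 m≢0) (subst (_≤ n) (ℕ.+-comm 1 m) (ℕ.≤∧≢⇒< m≤n m≢n)))

evalℚ-ℕ→ℚ : ∀ cs x → evalℚ cs (ℕ→ℚ x) ≡ ℕ→ℚ (evalℕ cs x)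
evalℚ-ℕ→ℚ []       x = refl
evalℚ-ℕ→ℚ (c ∷ cs) x = begin
  ℕ→ℚ c ℚ.+ ℕ→ℚ x ℚ.* evalℚ cs (ℕ→ℚ x)   ≡⟨ cong (λ e → ℕ→ℚ c ℚ.+ ℕ→ℚ x ℚ.* e) (evalℚ-ℕ→ℚ cs x) ⟩
  ℕ→ℚ c ℚ.+ ℕ→ℚ x ℚ.* ℕ→ℚ (evalℕ cs x)   ≡⟨ cong (ℕ→ℚ c ℚ.+_) (ℕ→ℚ-homo-* x (evalℕ cs x)) ⟨
  ℕ→ℚ c ℚ.+ ℕ→ℚ (x * evalℕ cs x)         ≡⟨ ℕ→ℚ-homo-+ c (x * evalℕ cs x) ⟨
  ℕ→ℚ (c + x * evalℕ cs x)                ∎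
  where open ≡-Reasoning

module _ {n} (a : Fin (ℕ.suc n) → ℕ) (ℓ : ℕ) (cs : List ℕ) where

  𝒫-0 : ∀ k → 𝒫 a ℓ cs k 0ℚ ≡ 0ℚ
  𝒫-0 k = trans (cong (frac (a k) (ℓ * a zero) ℚ.*_) (*-zeroˡ (evalℚ cs 0ℚ))) (*-zeroʳ (frac (a k) (ℓ * a zero)))

  Γ-0 : ∀ i → Γ a ℓ cs 0ℚ i ≡ 0ℚ
  Γ-0 zero    = refl
  Γ-0 (suc k) = 𝒫-0 (suc k)

  𝒫-ℕ→ℚ : ∀ k x → 𝒫 a ℓ cs k (ℕ→ℚ x) ≡ frac (a k * (x * evalℕ cs x)) (ℓ * a zero)
  𝒫-ℕ→ℚ k x = begin
    frac (a k) (ℓ * a zero) ℚ.* (ℕ→ℚ x ℚ.* evalℚ cs (ℕ→ℚ x))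
      ≡⟨ cong (λ e → frac (a k) (ℓ * a zero) ℚ.* (ℕ→ℚ x ℚ.* e)) (evalℚ-ℕ→ℚ cs x) ⟩
    frac (a k) (ℓ * a zero) ℚ.* (ℕ→ℚ x ℚ.* ℕ→ℚ (evalℕ cs x))
      ≡⟨ cong (frac (a k) (ℓ * a zero) ℚ.*_) (ℕ→ℚ-homo-* x (evalℕ cs x)) ⟨
    frac (a k) (ℓ * a zero) ℚ.* ℕ→ℚ (x * evalℕ cs x)
      ≡⟨ frac-*-ℕ→ℚ (a k) (ℓ * a zero) (x * evalℕ cs x) ⟩
    frac (a k * (x * evalℕ cs x)) (ℓ * a zero) ∎
    where open ≡-Reasoning

  module _ .{{_ : NonZero (ℓ * a zero)}} where

    𝒫-endpoint : evalℕ cs (a zero) ≡ ℓ → ∀ k → 𝒫 a ℓ cs k (ℕ→ℚ (a zero)) ≡ ℕ→ℚ (a k)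
    𝒫-endpoint P[a₀]≡ℓ k = begin
      𝒫 a ℓ cs k (ℕ→ℚ (a zero))                         ≡⟨ 𝒫-ℕ→ℚ k (a zero) ⟩
      frac (a k * (a zero * evalℕ cs (a zero))) (ℓ * a zero) ≡⟨ cong (λ m → frac (a k * m) (ℓ * a zero)) a₀P[a₀]≡ℓa₀ ⟩
      frac (a k * (ℓ * a zero)) (ℓ * a zero)                 ≡⟨ frac-cancel (a k) (ℓ * a zero) ⟩
      ℕ→ℚ (a k)                                              ∎
      where
      open ≡-Reasoning
      a₀P[a₀]≡ℓa₀ : a zero * evalℕ cs (a zero) ≡ ℓ * a zero
      a₀P[a₀]≡ℓa₀ = trans (cong (a zero *_) P[a₀]≡ℓ) (ℕ.*-comm (a zero) ℓ)

    Γ-endpoint : evalℕ cs (a zero) ≡ ℓ → ∀ i → Γ a ℓ cs (ℕ→ℚ (a zero)) i ≡ ℕ→ℚ (a i)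
    Γ-endpoint P[a₀]≡ℓ zero    = refl
    Γ-endpoint P[a₀]≡ℓ (suc k) = 𝒫-endpoint P[a₀]≡ℓ (suc k)

    𝒫-ℕ→ℚ-nonInt : Prime ℓ → ∀ {k x} → ℓ ∤ a k → ℓ ∤ x → ℓ ∤ evalℕ cs x → ¬ IsInt (𝒫 a ℓ cs k (ℕ→ℚ x))
    𝒫-ℕ→ℚ-nonInt ℓ-prime {k} {x} ℓ∤aₖ ℓ∤x ℓ∤P[x] 𝒫[x]∈ℤ =
      prime∤* ℓ-prime ℓ∤aₖ (prime∤* ℓ-prime ℓ∤x ℓ∤P[x]) (∣-trans (m∣m*n (a zero)) ℓa₀∣numerator)
      where
      ℓa₀∣numerator : ℓ * a zero ∣ a k * (x * evalℕ cs x)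
      ℓa₀∣numerator = IsInt-frac⇒∣ _ (ℓ * a zero) (subst IsInt (𝒫-ℕ→ℚ k x) 𝒫[x]∈ℤ)

lemma2p2 : (m : ℕ) → 1 ≤ m → (a : Fin (ℕ.suc m) → ℕ) → (∀ i → 1 ≤ a i) → 2 ≤ a zero →
  (ℓ : ℕ) → Prime ℓ → (∀ i → a i < ℓ) →
  (cs : List ℕ) → (cd : ℕ) → All (_< a zero) cs → cd < a zero → cd ≢ 0 →
  evalℕ (cs ∷ʳ cd) (a zero) ≡ ℓ →
  ((∀ i → Γ a ℓ (cs ∷ʳ cd) 0ℚ i ≡ 0ℚ)
    × (∀ i → Γ a ℓ (cs ∷ʳ cd) (ℕ→ℚ (a zero)) i ≡ ℕ→ℚ (a i)))
  × (∀ (x : ℕ) → 1 ≤ x → x + 1 ≤ a zero → ∀ (k : Fin m) →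
      ¬ IsInt (𝒫 a ℓ (cs ∷ʳ cd) (suc k) (ℕ→ℚ x)))
  × (∀ (x : ℚ) → 0ℚ ℚ.≤ x → x ℚ.≤ ℕ→ℚ (a zero) → (∀ i → IsInt (Γ a ℓ (cs ∷ʳ cd) x i)) →
      (x ≡ 0ℚ ⊎ x ≡ ℕ→ℚ (a zero)))
lemma2p2 (ℕ.suc m) _ a 1≤a _ ℓ ℓ-prime a<ℓ cs cd _ cd<a₀ cd≢0 P[a₀]≡ℓ =
  (Γ-0 a ℓ ds , Γ-endpoint a ℓ ds P[a₀]≡ℓ) , 𝒫-nonInt , Γ-lattice
  where
  a₀ : ℕ
  a₀ = a zero
  ds : List ℕ
  ds = cs ∷ʳ cd
  instance
    ℓa₀≢0 : NonZero (ℓ * a₀)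
    ℓa₀≢0 = ℕ.m*n≢0 ℓ a₀ {{prime⇒nonZero ℓ-prime}} {{>-nonZero (1≤a zero)}}

  P[x]<ℓ : ∀ {x} → x < a₀ → evalℕ ds x < ℓ
  P[x]<ℓ x<a₀ = subst (evalℕ ds _ <_) P[a₀]≡ℓ (evalℕ-∷ʳ-mono-< cs (ℕ.n≢0⇒n>0 cd≢0)
    (subst (cd <_) (sym P[a₀]≡ℓ) (ℕ.<-trans cd<a₀ (a<ℓ zero))) x<a₀)

  𝒫-nonInt : ∀ x → 1 ≤ x → x + 1 ≤ a₀ → ∀ k → ¬ IsInt (𝒫 a ℓ ds (suc k) (ℕ→ℚ x))
  𝒫-nonInt x 0<x x+1≤a₀ k = 𝒫-ℕ→ℚ-nonInt a ℓ ds ℓ-prime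
    (positive<prime⇒∤ (1≤a (suc k)) (a<ℓ (suc k)))
    (positive<prime⇒∤ 0<x (ℕ.<-trans x<a₀ (a<ℓ zero)))
    (positive<prime⇒∤ (evalℕ-∷ʳ-pos cs 0<x (ℕ.n≢0⇒n>0 cd≢0)) (P[x]<ℓ x<a₀))
    where
    x<a₀ : x < a₀
    x<a₀ = subst (_≤ a₀) (ℕ.+-comm x 1) x+1≤a₀

  Γ-lattice : ∀ x → 0ℚ ℚ.≤ x → x ℚ.≤ ℕ→ℚ a₀ → (∀ i → IsInt (Γ a ℓ ds x i)) → x ≡ 0ℚ ⊎ x ≡ ℕ→ℚ a₀
  Γ-lattice x 0≤x x≤a₀ Γ[x]∈ℤⁿ = IsInt∩[0,n]⇒endpoint (λ y → IsInt (𝒫 a ℓ ds (suc zero) y))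
    (λ y 0<y y+1≤a₀ → 𝒫-nonInt y 0<y y+1≤a₀ zero) 0≤x x≤a₀ (Γ[x]∈ℤⁿ zero) (Γ[x]∈ℤⁿ (suc zero))
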